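{- In selective compound Node-Kayles under normal play, the set $\mathcal{L}$ of integers $m\ge 0$ such that the single path $P_m$ is a $\mathcal{P}$-position is $$\mathcal{L}=\{5n:\ n\ge 0\}\cup\{5n+4:\ n\ge 0\}.$$
   Context: For $n\ge 0$, $P_n$ denotes the path on $n$ vertices ($P_0$ is the empty graph). A Node-Kayles move on a path $P_k$ with $k\ge 1$ chooses a vertex and deletes it together with its neighbours. The possible results are: $P_0$ if $k\in\{1,2\}$; $P_0$ or $P_1$ if $k=3$; and, for $k\ge 4$, $P_{k-2}$, $P_{k-3}$, or two paths $P_i,P_j$ with $j\ge i\ge1$, $i+j=k-3$. Selective compound Node-Kayles is played by two players who move alternately, starting from a single path. A position is a finite multiset of paths (components). A move consists in choosing any nonempty set of nonempty components and replacing each chosen component by the result of a Node-Kayles move on it; a split component yields two components. The game ends when all components are empty. Under normal play, the player who made the last move wins. A position is a $\mathcal{P}$-position if the second player (the one not moving next) has a winning strategy, and an $\mathcal{N}$-position otherwise. -}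

module Defs where

open import Data.Nat using (ℕ; zero; suc; _+_; _≤_)
open import Data.List using (List; []; _∷_; [_]; _++_)

-- A position is a finite list of path lengths (component P_c for each entry c);
-- order is irrelevant to the game, empty components P_0 are allowed.

data KMove : ℕ → List ℕ → Set where
  one   : KMove 1 [ 0 ]
  drop2 : ∀ k → KMove (suc (suc k)) [ k ]
  drop3 : ∀ k → KMove (suc (suc (suc k))) [ k ]
  split : ∀ i j → 1 ≤ i → i ≤ j → KMove (3 + i + j) (i ∷ j ∷ [])

data Sel : List ℕ → List ℕ → Set where
  nil  : Sel [] []
  keep : ∀ {c xs ys} → Sel xs ys → Sel (c ∷ xs) (c ∷ ys)
  pick : ∀ {c r xs ys} → KMove c r → Sel xs ys → Sel (c ∷ xs) (r ++ ys)

-- Selective compound move: a NONEMPTY set of components is moved in.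
data CMove : List ℕ → List ℕ → Set where
  keep : ∀ {c xs ys} → CMove xs ys → CMove (c ∷ xs) (c ∷ ys)
  pick : ∀ {c r xs ys} → KMove c r → Sel xs ys → CMove (c ∷ xs) (r ++ ys)

-- Normal play outcome classes (the game is finite: total vertex count strictly decreases).
data IsP : List ℕ → Set
data IsN : List ℕ → Set

data IsP where
  allN : ∀ {x} → (∀ {y} → CMove x y → IsN y) → IsP x

data IsN where
  someP : ∀ {x y} → CMove x y → IsP y → IsN x

-- A path is losing iff its length is 0 or 4 mod 5, and a position is a P-position iff all its
-- components are losing paths. No single Node-Kayles move takes a losing path to a position whose
-- components are all losing (the sums of two residues in {0, 4}, shifted by 3, avoid {0, 4}), so
-- any selective move from an all-losing position leaves some winning component. Conversely every
-- winning path P_c has a move to one losing path (P_1 → P_0, and P_{c-2} or P_{c-3} otherwise), and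
-- moving in all winning components simultaneously restores an all-losing position.
module Submission where

open import Defs
open import Data.Nat using (ℕ; zero; suc; _+_; _*_; _<_; _≤_; z<s)
open import Data.Nat.Properties using (≤-refl; +-mono-≤; +-monoʳ-≤; +-monoʳ-<; <⇒≤; m<n+m; +-identityʳ; *-suc)
open import Data.Nat.Induction using (<-wellFounded)
open import Induction.WellFounded using (Acc; acc)
open import Data.List using ([]; _∷_; [_]; _++_)
open import Data.Nat.ListAction using (sum)
open import Data.Nat.ListAction.Properties using (sum-++)
open import Data.List.Relation.Unary.All using (All; []; _∷_; all?)
open import Data.List.Relation.Unary.All.Properties using (++⁻ˡ; singleton⁻)
open import Data.Product using (Σ; ∃; _×_; _,_; proj₁; proj₂)
open import Data.Sum using (_⊎_; inj₁; inj₂)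
open import Data.Unit using (⊤; tt)
open import Data.Empty using (⊥; ⊥-elim)
open import Relation.Nullary using (¬_; Dec; yes; no)
open import Relation.Nullary.Decidable using (decidable-stable)
open import Relation.Binary.PropositionalEquality using (_≡_; refl; cong; sym; subst)
open import Function.Bundles using (_⇔_; mk⇔)
open import Function.Construct.Composition using (_⇔-∘_)

Losing : ℕ → Set
Losing 0 = ⊤
Losing 1 = ⊥
Losing 2 = ⊥
Losing 3 = ⊥
Losing 4 = ⊤
Losing (suc (suc (suc (suc (suc m))))) = Losing m

losing? : ∀ m → Dec (Losing m)
losing? 0 = yes tt
losing? 1 = no λ ()
losing? 2 = no λ ()
losing? 3 = no λ ()
losing? 4 = yes tt
losing? (suc (suc (suc (suc (suc m))))) = losing? m

losing-5*+ : ∀ n {r} → Losing r → Losing (5 * n + r)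
losing-5*+ zero    l = l
losing-5*+ (suc n) {r} l = subst Losing (cong (_+ r) (sym (*-suc 5 n))) (losing-5*+ n l)

Losing⇔≡0or4mod5 : ∀ m → Losing m ⇔ (Σ ℕ (λ n → m ≡ 5 * n) ⊎ Σ ℕ (λ n → m ≡ 5 * n + 4))
Losing⇔≡0or4mod5 m = mk⇔ (to m) from
  where
  to : ∀ m → Losing m → Σ ℕ (λ n → m ≡ 5 * n) ⊎ Σ ℕ (λ n → m ≡ 5 * n + 4)
  to 0 _ = inj₁ (0 , refl)
  to 4 _ = inj₂ (0 , refl)
  to (suc (suc (suc (suc (suc m))))) l with to m l
  ... | inj₁ (n , refl) = inj₁ (suc n , sym (*-suc 5 n))
  ... | inj₂ (n , refl) = inj₂ (suc n , sym (cong (_+ 4) (*-suc 5 n)))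

  from : Σ ℕ (λ n → m ≡ 5 * n) ⊎ Σ ℕ (λ n → m ≡ 5 * n + 4) → Losing m
  from (inj₁ (n , refl)) = subst Losing (+-identityʳ (5 * n)) (losing-5*+ n tt)
  from (inj₂ (n , refl)) = losing-5*+ n tt

losing⇒¬losing-2+ : ∀ k → Losing k → ¬ Losing (2 + k)
losing⇒¬losing-2+ 0 _ ()
losing⇒¬losing-2+ 4 _ ()
losing⇒¬losing-2+ (suc (suc (suc (suc (suc k))))) = losing⇒¬losing-2+ k

losing⇒¬losing-3+ : ∀ k → Losing k → ¬ Losing (3 + k)
losing⇒¬losing-3+ 0 _ ()
losing⇒¬losing-3+ 4 _ ()
losing⇒¬losing-3+ (suc (suc (suc (suc (suc k))))) = losing⇒¬losing-3+ k

losing⇒¬losing-3+i+j : ∀ i j → Losing i → Losing j → ¬ Losing (3 + i + j)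
losing⇒¬losing-3+i+j 0 j _ = losing⇒¬losing-3+ j
losing⇒¬losing-3+i+j 4 j _ = losing⇒¬losing-2+ j
losing⇒¬losing-3+i+j (suc (suc (suc (suc (suc i))))) = losing⇒¬losing-3+i+j i

KMove-losing⇒¬All-losing : ∀ {c r} → KMove c r → Losing c → ¬ All Losing r
KMove-losing⇒¬All-losing one         ()
KMove-losing⇒¬All-losing (drop2 k)   l (lk ∷ []) = losing⇒¬losing-2+ k lk l
KMove-losing⇒¬All-losing (drop3 k)   l (lk ∷ []) = losing⇒¬losing-3+ k lk l
KMove-losing⇒¬All-losing (split i j _ _) l (li ∷ lj ∷ []) = losing⇒¬losing-3+i+j i j li lj l

KMove-to-losing : ∀ c → ¬ Losing c → ∃ λ k → Losing k × KMove c [ k ]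
KMove-to-losing 0 ¬l = ⊥-elim (¬l tt)
KMove-to-losing 1 _ = 0 , tt , one
KMove-to-losing 2 _ = 0 , tt , drop2 0
KMove-to-losing 3 _ = 0 , tt , drop3 0
KMove-to-losing 4 ¬l = ⊥-elim (¬l tt)
KMove-to-losing (suc (suc (suc (suc (suc c))))) ¬l with KMove-to-losing c ¬l
... | _ , _ , one     = 4 , tt , drop2 4
... | k , l , drop2 k = 5 + k , l , drop2 (5 + k)
... | k , l , drop3 k = 5 + k , l , drop3 (5 + k)

KMove-sum< : ∀ {c r} → KMove c r → sum r < c
KMove-sum< one = z<s
KMove-sum< (drop2 k) rewrite +-identityʳ k = m<n+m k z<s
KMove-sum< (drop3 k) rewrite +-identityʳ k = m<n+m k z<s
KMove-sum< (split i j _ _) rewrite +-identityʳ j = m<n+m (i + j) {3} z<s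

Sel-sum≤ : ∀ {xs ys} → Sel xs ys → sum ys ≤ sum xs
Sel-sum≤ nil = ≤-refl
Sel-sum≤ (keep s) = +-monoʳ-≤ _ (Sel-sum≤ s)
Sel-sum≤ (pick {r = r} {ys = ys} k s) rewrite sum-++ r ys = +-mono-≤ (<⇒≤ (KMove-sum< k)) (Sel-sum≤ s)

CMove-sum< : ∀ {xs ys} → CMove xs ys → sum ys < sum xs
CMove-sum< (keep m) = +-monoʳ-< _ (CMove-sum< m)
CMove-sum< (pick {r = r} {ys = ys} k s) rewrite sum-++ r ys = +-mono-≤ (KMove-sum< k) (Sel-sum≤ s)

CMove-All-losing⇒¬All-losing : ∀ {xs ys} → CMove xs ys → All Losing xs → ¬ All Losing ys
CMove-All-losing⇒¬All-losing (keep m) (_ ∷ ls) (_ ∷ ls′) = CMove-All-losing⇒¬All-losing m ls ls′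
CMove-All-losing⇒¬All-losing (pick {r = r} k _) (l ∷ _) ls′ = KMove-losing⇒¬All-losing k l (++⁻ˡ r ls′)

Sel-to-All-losing : ∀ xs → ∃ λ ys → Sel xs ys × All Losing ys
Sel-to-All-losing [] = [] , nil , []
Sel-to-All-losing (c ∷ xs) with Sel-to-All-losing xs | losing? c
... | ys , s , ls | yes l = c ∷ ys , keep s , l ∷ ls
... | ys , s , ls | no ¬l with KMove-to-losing c ¬l
...   | k , lk , move = k ∷ ys , pick move s , lk ∷ ls

CMove-to-All-losing : ∀ xs → ¬ All Losing xs → ∃ λ ys → CMove xs ys × All Losing ys
CMove-to-All-losing [] ¬ls = ⊥-elim (¬ls [])
CMove-to-All-losing (c ∷ xs) ¬ls with losing? c
... | yes l with CMove-to-All-losing xs (λ ls → ¬ls (l ∷ ls))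
...   | ys , m , ls = c ∷ ys , keep m , l ∷ ls
CMove-to-All-losing (c ∷ xs) ¬ls | no ¬l with KMove-to-losing c ¬l | Sel-to-All-losing xs
...   | k , lk , move | ys , s , ls = k ∷ ys , pick move s , lk ∷ ls

classify : ∀ xs → Acc _<_ (sum xs) → (All Losing xs → IsP xs) × (¬ All Losing xs → IsN xs)
classify xs (acc rec) = isP , isN
  where
  isP : All Losing xs → IsP xs
  isP ls = allN λ {ys} m →
    proj₂ (classify ys (rec (CMove-sum< m))) (CMove-All-losing⇒¬All-losing m ls)

  isN : ¬ All Losing xs → IsN xs
  isN ¬ls with CMove-to-All-losing xs ¬ls
  ... | ys , m , ls = someP m (proj₁ (classify ys (rec (CMove-sum< m))) ls)

IsN⇒¬IsP : ∀ {xs} → IsN xs → ¬ IsP xs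
IsN⇒¬IsP (someP m p) (allN f) = IsN⇒¬IsP (f m) p

IsP⇔All-losing : ∀ xs → IsP xs ⇔ All Losing xs
IsP⇔All-losing xs = mk⇔ to (proj₁ classified)
  where
  classified : (All Losing xs → IsP xs) × (¬ All Losing xs → IsN xs)
  classified = classify xs (<-wellFounded (sum xs))

  to : IsP xs → All Losing xs
  to p = decidable-stable (all? losing? xs) λ ¬ls → IsN⇒¬IsP (proj₂ classified ¬ls) p

corollary6 : ∀ (m : ℕ) →
    IsP [ m ] ⇔ (Σ ℕ (λ n → m ≡ 5 * n) ⊎ Σ ℕ (λ n → m ≡ 5 * n + 4))
corollary6 m = Losing⇔≡0or4mod5 m ⇔-∘ (mk⇔ singleton⁻ (_∷ []) ⇔-∘ IsP⇔All-losing [ m ])
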